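{- Let $V$ be a set of $n \ge 1$ nails and $1 \le k \le n$. Consider the following construction of an expression $w$ (Demaine-perspective binary splitting). If $n = 1$, take the single nail. If $n \ge 2$, split $V$ into disjoint nonempty parts $L$, $R$ with $|L| = n_1$, $|R| = n_2$ (any such split). For each feasible $j$, i.e. $\max(0,k-n_2) \le j \le \min(k,n_1)$, form the expression $D_j = H_k(R)$ if $j = 0$; $D_j = H_j(L) + H_{k-j}(R)$ if $0 < j < k$; $D_j = H_k(L)$ if $j = k$; here $H_t(U)$ denotes any solution of the specification $\mathrm{kof}(t,U)$ (for instance, one produced recursively by this same construction). Then combine the expressions $D_j$ into a single expression by a commutator tree chosen by Huffman placement: repeatedly replace two currently shortest expressions (ties and the order of the two arguments broken arbitrarily) by their commutator, until one expression $w$ remains. Then $w$ is a solution of the $k$-out-of-$n$ puzzle on $V$, i.e. it solves $\mathrm{kof}(k,V)$.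
   Context: Expressions are elements of the free group on the nails, written additively: $+$ is the non-commutative group operation, $-x$ the inverse, $0$ the identity (empty word); length is the number of signed letters. The commutator is $[a,b] = a + b - a - b$. For a set $S$ of nails, $h|_S$ denotes $h$ with every variable in $S$ set to $0$. A specification on a finite nail set $U$ is a monotone function $f : 2^U \to \{\mathsf{hang},\mathsf{fall}\}$ (order $\mathsf{hang} < \mathsf{fall}$) with $f(U) = \mathsf{fall}$; an expression $h$ on $U$ solves $f$ if for every $S \subseteq U$: $h|_S = 0 \iff f(S) = \mathsf{fall}$. For $1 \le t \le |U|$, $\mathrm{kof}(t,U)$ is the specification with $\mathrm{kof}(t,U)(S) = \mathsf{fall}$ iff $|S| \ge t$. A solution to the $k$-out-of-$n$ puzzle on $V$ ($|V| = n$, Demaine's convention) is an expression $w$ in the variables of $V$ with $w \ne 0$, $w|_S = 0$ whenever $|S| = k$, and $w|_S \ne 0$ whenever $|S| < k$; equivalently, $w$ solves $\mathrm{kof}(k,V)$. -}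

module Defs where

open import Data.Bool using (Bool; true; false; not; if_then_else_; _∧_; _xor_)
open import Relation.Nullary.Decidable using (⌊_⌋)
open import Data.Nat using (ℕ; zero; suc; _∸_; _⊓_; _≤_; _≟_; _≤ᵇ_)
open import Data.Fin using (Fin)
import Data.Fin as Fin
open import Data.Fin.Subset using (Subset; _∈_; _∉_; _⊆_; ∣_∣; ⁅_⁆; _∪_)
open import Data.Vec using (lookup)
open import Data.List using (List; []; _∷_; _++_; reverse; map; length; upTo)
open import Data.List.Relation.Unary.All using (All)
open import Data.List.Membership.Propositional using () renaming (_∈_ to _∈ₗ_)
open import Data.List.Relation.Binary.Permutation.Propositional using (_↭_)
open import Data.Product using (_×_; _,_; proj₁)
open import Function.Bundles using (_⇔_)
open import Relation.Binary.PropositionalEquality using (_≡_)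
open import Relation.Nullary using (yes; no)

-- Nails are the elements of Fin N (for an arbitrary ambient N); finite
-- nail sets are subsets  Subset N.

-- A signed letter: a nail together with a sign (true = +x, false = -x).
Letter : ℕ → Set
Letter N = Fin N × Bool

-- Expressions are words over signed letters; the free-group element they
-- denote is given by free reduction (see `reduce`).
Word : ℕ → Set
Word N = List (Letter N)

module _ {N : ℕ} where

  inverseOf : Letter N → Letter N → Bool
  inverseOf (i , s) (j , t) = ⌊ Fin._≟_ i j ⌋ ∧ (s xor t)

  push : Letter N → Word N → Word N
  push x []       = x ∷ []
  push x (y ∷ w)  = if inverseOf x y then w else (x ∷ y ∷ w)

  reduce : Word N → Word N
  reduce []      = []
  reduce (x ∷ w) = push x (reduce w)

  IsZero : Word N → Set
  IsZero h = reduce h ≡ []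

  infixl 6 _⊕_
  _⊕_ : Word N → Word N → Word N
  a ⊕ b = a ++ b

  neg : Word N → Word N
  neg a = reverse (map (λ { (i , s) → (i , not s) }) a)

  comm : Word N → Word N → Word N
  comm a b = a ⊕ b ⊕ neg a ⊕ neg b

  len : Word N → ℕ
  len = length

  -- h|_S : set every variable of S to 0 (delete its letters).
  restrict : Subset N → Word N → Word N
  restrict S []            = []
  restrict S ((i , s) ∷ h) with lookup S i
  ... | true  = restrict S h
  ... | false = (i , s) ∷ restrict S h

  IsOn : Subset N → Word N → Set
  IsOn U h = All (λ l → proj₁ l ∈ U) h

data Outcome : Set where
  hang fall : Outcome

module _ {N : ℕ} where

  Spec : Set
  Spec = Subset N → Outcome

  Solves : Subset N → Spec → Word N → Set
  Solves U f h = ∀ (S : Subset N) → S ⊆ U → (IsZero (restrict S h) ⇔ (f S ≡ fall))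

  kof : ℕ → Subset N → Spec
  kof t U S = if t ≤ᵇ ∣ S ∣ then fall else hang

module _ {N : ℕ} where

  data Huffman : List (Word N) → Word N → Set where
    done : ∀ {w} → Huffman (w ∷ []) w
    step : ∀ {xs rest w} (a b : Word N) →
           xs ↭ (a ∷ b ∷ rest) →
           (∀ {c} → c ∈ₗ rest → len a ≤ len c) →
           (∀ {c} → c ∈ₗ rest → len b ≤ len c) →
           Huffman (comm a b ∷ rest) w →
           Huffman xs w

  range : ℕ → ℕ → List ℕ
  range lo hi = map (lo Data.Nat.+_) (upTo (suc hi ∸ lo))
    where import Data.Nat

  Dexpr : ℕ → (ℕ → Word N) → (ℕ → Word N) → ℕ → Word N
  Dexpr k HL HR j with j ≟ 0 | j ≟ k
  ... | yes _ | _     = HR k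
  ... | no _  | yes _ = HL k
  ... | no _  | no _  = HL j ⊕ HR (k ∸ j)

  Dlist : ℕ → ℕ → ℕ → (ℕ → Word N) → (ℕ → Word N) → List (Word N)
  Dlist k n₁ n₂ HL HR = map (Dexpr k HL HR) (range (k ∸ n₂) (k ⊓ n₁))

  SolutionFamily : Subset N → (ℕ → Word N) → Set
  SolutionFamily U H = ∀ t → 1 ≤ t → t ≤ ∣ U ∣ →
                       IsOn U (H t) × Solves U (kof t U) (H t)

  data Built : Subset N → ℕ → Word N → Set where
    single : ∀ {k} (v : Fin N) → Built ⁅ v ⁆ k ((v , true) ∷ [])
    split  : ∀ {k w} (L R : Subset N) →
             1 ≤ ∣ L ∣ → 1 ≤ ∣ R ∣ →
             (∀ {x} → x ∈ L → x ∉ R) →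
             (HL HR : ℕ → Word N) →
             SolutionFamily L HL → SolutionFamily R HR →
             Huffman (Dlist k ∣ L ∣ ∣ R ∣ HL HR) w →
             Built (L ∪ R) k w

-- Setting the nails of S to 0 is the endomorphism `restrict S` of the free group, and the
-- leaf D_j of the construction vanishes at S exactly when j ≤ |S ∩ L| and k − j ≤ |S ∩ R|
-- (the leaf "falls" at S); some feasible j falls at S iff |S| ≥ k.  It therefore suffices
-- that a commutator tree whose leaves carry distinct indices vanishes at S iff one of its
-- leaves falls.  If [a, b] vanishes at S while no leaf below it falls, then a|S and b|S
-- are commuting nontrivial elements of a free group, hence powers of a common element.
-- Enlarging S to a set T at which exactly one leaf falls, say one below a, kills a|T;
-- free groups being torsion-free, this kills the common root and so b|T, whence a leaf
-- below b falls at T as well: a contradiction.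

module Submission where

open import Defs
open import Data.Bool using (true; false; not; _∧_)
import Data.Bool as Bool
open import Data.Bool.Properties using (not-involutive; xor-same; ∧-identityʳ)
open import Data.Empty using (⊥; ⊥-elim)
open import Data.Fin using (Fin)
import Data.Fin as Fin
open import Data.Fin.Subset using (Subset; _∈_; _∉_; _⊆_; ∣_∣; _∩_; _∪_; ⁅_⁆) renaming (⊥ to ∅)
open import Data.Fin.Subset.Properties
  using (drop-∷-⊆; s⊆s; out⊆; ⊆-antisym; p⊆q⇒∣p∣≤∣q∣; p∩q⊆q; ∣p∩q∣≤∣q∣; x∈p∩q⁺; x∈p∩q⁻; x∈p∪q⁻;
         p⊆p∪q; q⊆p∪q; ∪-comm; x∈⁅x⁆; x∈⁅y⁆⇒x≡y; ∣⊥∣≡0)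
open import Data.List using (List; []; _∷_; _++_; [_]; map; reverse; foldr; length; drop; concat; filter; initLast; _∷ʳ′_)
open import Data.List.Properties
  using (map-∘; foldr-++; map-++; reverse-++; ++-assoc; ++-identityʳ; length-++; length-++-comm; ++-cancelˡ;
         ++-conicalˡ; ++-conicalʳ; ∷-injective)
open import Data.List.Extrema.Nat using (min; max; argmin-sel; argmax-sel; min≤⊤; min≤xs; v≤max⁺; xs≤max)
open import Data.List.Membership.Propositional using (find; lose) renaming (_∈_ to _∈ₗ_)
open import Data.List.Membership.Propositional.Properties
  using (∈-++⁺ˡ; ∈-++⁺ʳ; ∈-++⁻; ∈-filter⁺; ∈-filter⁻; ∈-map⁺; ∈-map⁻; ∈-upTo⁺; ∈-upTo⁻)
open import Data.List.Relation.Binary.Disjoint.Propositional using (Disjoint)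
open import Data.List.Relation.Binary.Permutation.Propositional using (_↭_; ↭-refl; ↭-sym; ↭-trans; ↭-reflexive; ↭⇒↭ₛ)
import Data.List.Relation.Binary.Permutation.Propositional as ↭
import Data.List.Relation.Binary.Permutation.Propositional.Properties as ↭ₚ
import Data.List.Relation.Binary.Permutation.Setoid.Properties as ↭ₛ
open import Data.List.Relation.Unary.All using (All; []; _∷_)
import Data.List.Relation.Unary.All as All
import Data.List.Relation.Unary.All.Properties as Allₚ
open import Data.List.Relation.Unary.AllPairs using (_∷_)
open import Data.List.Relation.Unary.Any using (Any; here; there; any?)
import Data.List.Relation.Unary.Any.Properties as Any
open import Data.List.Relation.Unary.Unique.Propositional using (Unique)
import Data.List.Relation.Unary.Unique.Propositional.Properties as Uniqueₚ
open import Data.Nat using (ℕ; zero; suc; _+_; _∸_; _⊓_; _≤_; _<_; z≤n; s≤s; _≟_; _≤?_; _<?_; _≤ᵇ_)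
open import Data.Nat.Properties
  using (≤-refl; ≤-trans; ≤-antisym; ≤-reflexive; ≤-pred; <-irrefl; <⇒≤; ≰⇒>; ≮⇒≥; ≤∧≢⇒<; 1+n≰n; n≢0⇒n>0;
         m≤n⇒m≤1+n; ≤ᵇ⇒≤; ≤⇒≤ᵇ; +-comm; +-suc; +-cancelˡ-≡; m≤m+n; m+n≤o⇒n≤o; +-monoʳ-≤; +-mono-≤;
         n∸n≡0; m∸n≤m; ∸-monoˡ-≤; ∸-cancelʳ-≤; +-∸-assoc; m+[n∸m]≡n; m<n⇒0<n∸m; m≤n+o⇒m∸n≤o; m≤n+m∸n;
         m≤m⊔n; m≤n⊔m; ⊔-lub; ⊓-glb; ⊓-monoʳ-≤; m⊓n≤m; m⊓n≤n; ∸-distribˡ-⊓-⊔)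
open import Data.Product using (∃₂; ∃-syntax; _×_; _,_; proj₁; proj₂)
open import Data.Sum using (_⊎_; inj₁; inj₂; [_,_]′)
open import Data.Unit using (⊤; tt)
open import Data.Vec using ([]; _∷_; lookup; here; there)
open import Data.Vec.Properties using ([]=⇒lookup; lookup⇒[]=; lookup-zipWith)
open import Function using (id; _∘_; _∘′_)
open import Function.Bundles using (_⇔_; mk⇔; Equivalence)
open import Function.Properties.Equivalence using (⇔-setoid)
open import Level using (0ℓ)
open import Relation.Binary.Bundles using (Setoid)
open import Relation.Binary.PropositionalEquality
  using (_≡_; _≢_; refl; sym; trans; cong; cong₂; subst; subst₂; module ≡-Reasoning)
open import Relation.Binary.PropositionalEquality.Properties using (setoid)
import Relation.Binary.Reasoning.Setoid as SetoidReasoning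
open import Relation.Nullary using (¬_; Dec; yes; no; _×-dec_)

module _ {N : ℕ} where

  -- Free reduction and the free group

  inv : Letter N → Letter N
  inv (i , s) = i , not s

  inv-involutive : (x : Letter N) → inv (inv x) ≡ x
  inv-involutive (i , s) = cong (i ,_) (not-involutive s)

  inverseOf-inv : (x : Letter N) → inverseOf x (inv x) ≡ true
  inverseOf-inv (i , s) with i Fin.≟ i
  ... | no i≢i = ⊥-elim (i≢i refl)
  ... | yes _ with s
  ...   | true  = refl
  ...   | false = refl

  inverseOf-invˡ : (x : Letter N) → inverseOf (inv x) x ≡ true
  inverseOf-invˡ x = subst (λ y → inverseOf (inv x) y ≡ true) (inv-involutive x) (inverseOf-inv (inv x))

  inverseOf⇒≡inv : (x y : Letter N) → inverseOf x y ≡ true → y ≡ inv x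
  inverseOf⇒≡inv (i , s) (j , t) e with i Fin.≟ j
  inverseOf⇒≡inv (i , true)  (.i , false) _  | yes refl = refl
  inverseOf⇒≡inv (i , false) (.i , true)  _  | yes refl = refl
  inverseOf⇒≡inv (i , true)  (.i , true)  () | yes refl
  inverseOf⇒≡inv (i , false) (.i , false) () | yes refl
  inverseOf⇒≡inv (i , s)     (j , t)      () | no _

  inverseOf-irrefl : (x : Letter N) → inverseOf x x ≡ false
  inverseOf-irrefl (i , s) with i Fin.≟ i
  ... | no _  = refl
  ... | yes _ = xor-same s

  inverseOf-inv-swap : (x y : Letter N) → inverseOf (inv y) (inv x) ≡ inverseOf x y
  inverseOf-inv-swap (i , s) (j , t) with j Fin.≟ i | i Fin.≟ j
  ... | yes refl | no i≢i  = ⊥-elim (i≢i refl)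
  ... | no j≢j   | yes refl = ⊥-elim (j≢j refl)
  ... | no _     | no _     = refl
  ... | yes refl | yes _ with s | t
  ...   | true  | true  = refl
  ...   | true  | false = refl
  ...   | false | true  = refl
  ...   | false | false = refl

  Reduced : Word N → Set
  Reduced []          = ⊤
  Reduced (x ∷ [])    = ⊤
  Reduced (x ∷ y ∷ w) = inverseOf x y ≡ false × Reduced (y ∷ w)

  Reduced-tail : ∀ x w → Reduced (x ∷ w) → Reduced w
  Reduced-tail x []      _       = tt
  Reduced-tail x (y ∷ w) (_ , r) = r

  Reduced-++ˡ : ∀ a {b} → Reduced (a ++ b) → Reduced a
  Reduced-++ˡ []          _       = tt
  Reduced-++ˡ (x ∷ [])    _       = tt
  Reduced-++ˡ (x ∷ y ∷ a) (e , r) = e , Reduced-++ˡ (y ∷ a) r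

  Reduced-++ʳ : ∀ a {b} → Reduced (a ++ b) → Reduced b
  Reduced-++ʳ []      r = r
  Reduced-++ʳ (x ∷ a) r = Reduced-++ʳ a (Reduced-tail x _ r)

  Reduced-glue : ∀ a b {c} → b ≢ [] → Reduced (a ++ b) → Reduced (b ++ c) → Reduced (a ++ b ++ c)
  Reduced-glue []          b       _    _       r = r
  Reduced-glue (x ∷ [])    []      b≢[] _       _ = ⊥-elim (b≢[] refl)
  Reduced-glue (x ∷ [])    (y ∷ b) _    (e , _) r = e , r
  Reduced-glue (x ∷ y ∷ a) b       b≢[] (e , r) r′ = e , Reduced-glue (y ∷ a) b b≢[] r r′

  push-reduced : ∀ x s → Reduced s → Reduced (push x s)
  push-reduced x []      _ = tt
  push-reduced x (y ∷ s) r with inverseOf x y in e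
  ... | true  = Reduced-tail y s r
  ... | false = e , r

  push-∷ : ∀ x w → Reduced (x ∷ w) → push x w ≡ x ∷ w
  push-∷ x []      _       = refl
  push-∷ x (y ∷ w) (e , _) rewrite e = refl

  push-cancel-inv : ∀ x {s} → Reduced s → push x (push (inv x) s) ≡ s
  push-cancel-inv x {[]} _ rewrite inverseOf-inv x = refl
  push-cancel-inv x {y ∷ s} r with inverseOf (inv x) y in e
  ... | false rewrite inverseOf-inv x = refl
  ... | true with inverseOf⇒≡inv (inv x) y e
  ...   | refl rewrite inv-involutive x = push-∷ x s r

  push-cancel : ∀ {x y} s → inverseOf x y ≡ true → Reduced s → push x (push y s) ≡ s
  push-cancel {x} {y} s e r with inverseOf⇒≡inv x y e
  ... | refl = push-cancel-inv x r

  act : Word N → Word N → Word N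
  act a s = foldr push s a

  act-reduced : ∀ a {s} → Reduced s → Reduced (act a s)
  act-reduced []      r = r
  act-reduced (x ∷ a) r = push-reduced x _ (act-reduced a r)

  act-++ : ∀ a b s → act (a ++ b) s ≡ act a (act b s)
  act-++ a b s = foldr-++ push s a b

  reduce≡act : ∀ a → reduce a ≡ act a []
  reduce≡act []      = refl
  reduce≡act (x ∷ a) = cong (push x) (reduce≡act a)

  reduce-reduced : ∀ a → Reduced (reduce a)
  reduce-reduced a = subst Reduced (sym (reduce≡act a)) (act-reduced a tt)

  reduce-of-reduced : ∀ {w} → Reduced w → reduce w ≡ w
  reduce-of-reduced {[]}        _       = refl
  reduce-of-reduced {x ∷ []}    _       = refl
  reduce-of-reduced {x ∷ y ∷ w} (e , r) rewrite reduce-of-reduced r | e = refl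

  -- Words are compared through their action on reduced words; by ≈⇒reduce≡ and reduce≡⇒≈
  -- this is equality of free reductions, i.e. equality in the free group.
  infix 4 _≈_
  record _≈_ (a b : Word N) : Set where
    constructor mk≈
    field act-≡ : ∀ s → Reduced s → act a s ≡ act b s
  open _≈_ public

  ≈-refl : ∀ {a} → a ≈ a
  ≈-refl = mk≈ λ _ _ → refl

  ≈-sym : ∀ {a b} → a ≈ b → b ≈ a
  ≈-sym a≈b = mk≈ λ s r → sym (act-≡ a≈b s r)

  ≈-trans : ∀ {a b c} → a ≈ b → b ≈ c → a ≈ c
  ≈-trans a≈b b≈c = mk≈ λ s r → trans (act-≡ a≈b s r) (act-≡ b≈c s r)

  ≡⇒≈ : ∀ {a b} → a ≡ b → a ≈ b
  ≡⇒≈ refl = ≈-refl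

  ≈-setoid : Setoid _ _
  ≈-setoid = record
    { Carrier = Word N
    ; _≈_ = _≈_
    ; isEquivalence = record { refl = ≈-refl ; sym = ≈-sym ; trans = ≈-trans }
    }

  module ≈-Reasoning = SetoidReasoning ≈-setoid

  ++-cong : ∀ {a a′ b b′} → a ≈ a′ → b ≈ b′ → a ++ b ≈ a′ ++ b′
  ++-cong {a} {a′} {b} {b′} a≈a′ b≈b′ = mk≈ λ s r → begin
    act (a ++ b) s     ≡⟨ act-++ a b s ⟩
    act a (act b s)    ≡⟨ cong (act a) (act-≡ b≈b′ s r) ⟩
    act a (act b′ s)   ≡⟨ act-≡ a≈a′ _ (act-reduced b′ r) ⟩
    act a′ (act b′ s)  ≡⟨ act-++ a′ b′ s ⟨
    act (a′ ++ b′) s   ∎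
    where open ≡-Reasoning

  act-push : ∀ x r {s} → Reduced s → act (push x r) s ≡ push x (act r s)
  act-push x []      _ = refl
  act-push x (y ∷ r) rs with inverseOf x y in e
  ... | true  = sym (push-cancel (act r _) e (act-reduced r rs))
  ... | false = refl

  act-reduce : ∀ a {s} → Reduced s → act a s ≡ act (reduce a) s
  act-reduce []      _  = refl
  act-reduce (x ∷ a) rs = trans (cong (push x) (act-reduce a rs)) (sym (act-push x (reduce a) rs))

  ≈-reduce : ∀ a → a ≈ reduce a
  ≈-reduce a = mk≈ λ _ → act-reduce a

  ≈⇒reduce≡ : ∀ {a b} → a ≈ b → reduce a ≡ reduce b
  ≈⇒reduce≡ {a} {b} a≈b = trans (reduce≡act a) (trans (act-≡ a≈b [] tt) (sym (reduce≡act b)))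

  reduce≡⇒≈ : ∀ {a b} → reduce a ≡ reduce b → a ≈ b
  reduce≡⇒≈ {a} {b} e = ≈-trans (≈-reduce a) (≈-trans (≡⇒≈ e) (≈-sym (≈-reduce b)))

  IsZero⇔≈[] : ∀ {h} → IsZero h ⇔ h ≈ []
  IsZero⇔≈[] = mk⇔ reduce≡⇒≈ ≈⇒reduce≡

  length-push : ∀ x (s : Word N) → length (push x s) ≤ suc (length s)
  length-push x []      = ≤-refl
  length-push x (y ∷ s) with inverseOf x y
  ... | true  = m≤n⇒m≤1+n (m≤n⇒m≤1+n ≤-refl)
  ... | false = ≤-refl

  push-no-cancel : ∀ x (s : Word N) → suc (length s) ≤ length (push x s) → push x s ≡ x ∷ s
  push-no-cancel x []      _  = refl
  push-no-cancel x (y ∷ s) le with inverseOf x y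
  ... | true  = ⊥-elim (<-irrefl refl (m≤n⇒m≤1+n le))
  ... | false = refl

  length-reduce : (w : Word N) → length (reduce w) ≤ length w
  length-reduce []      = z≤n
  length-reduce (x ∷ w) = ≤-trans (length-push x (reduce w)) (s≤s (length-reduce w))

  reduce-length⇒id : (w : Word N) → length w ≤ length (reduce w) → reduce w ≡ w
  reduce-length⇒id []      _  = refl
  reduce-length⇒id (x ∷ w) le = begin
    push x (reduce w) ≡⟨ push-no-cancel x (reduce w) (≤-trans (s≤s (length-reduce w)) le) ⟩
    x ∷ reduce w      ≡⟨ cong (x ∷_) (reduce-length⇒id w (≤-pred (≤-trans le (length-push x (reduce w))))) ⟩
    x ∷ w             ∎
    where open ≡-Reasoning

  reduced-≈⇒≡ : ∀ {a b} → Reduced a → b ≈ a → length b ≡ length a → b ≡ a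
  reduced-≈⇒≡ {a} {b} ra b≈a |b|≡|a| = begin
    b        ≡⟨ reduce-length⇒id b (≤-reflexive (trans |b|≡|a| (cong length (sym reduceb≡a)))) ⟨
    reduce b ≡⟨ reduceb≡a ⟩
    a        ∎
    where
      open ≡-Reasoning
      reduceb≡a : reduce b ≡ a
      reduceb≡a = trans (≈⇒reduce≡ b≈a) (reduce-of-reduced ra)

  neg-++ : (a b : Word N) → neg (a ++ b) ≡ neg b ++ neg a
  neg-++ a b = trans (cong reverse (map-++ _ a b)) (reverse-++ (map _ a) (map _ b))

  neg-∷ : ∀ x (a : Word N) → neg (x ∷ a) ≡ neg a ++ [ inv x ]
  neg-∷ x a = neg-++ [ x ] a

  neg-≢[] : {a : Word N} → a ≢ [] → neg a ≢ []
  neg-≢[] {[]}    a≢[] _ = a≢[] refl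
  neg-≢[] {x ∷ a} _    e with () ← ++-conicalʳ (neg a) [ inv x ] (trans (sym (neg-∷ x a)) e)

  Reduced-neg : ∀ a → Reduced a → Reduced (neg a)
  Reduced-neg []          _       = tt
  Reduced-neg (x ∷ [])    _       = tt
  Reduced-neg (x ∷ y ∷ a) (e , r) = subst Reduced (sym (neg-++ (x ∷ y ∷ []) a))
    (Reduced-glue (neg a) [ inv y ] (λ ())
      (subst Reduced (neg-∷ y a) (Reduced-neg (y ∷ a) r))
      (trans (inverseOf-inv-swap x y) e , tt))

  act-neg-act : ∀ a {s} → Reduced s → act (neg a) (act a s) ≡ s
  act-neg-act []      _ = refl
  act-neg-act (x ∷ a) {s} r = begin
    act (neg (x ∷ a)) (push x (act a s))          ≡⟨ cong (λ b → act b (push x (act a s))) (neg-∷ x a) ⟩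
    act (neg a ++ [ inv x ]) (push x (act a s))   ≡⟨ act-++ (neg a) [ inv x ] _ ⟩
    act (neg a) (push (inv x) (push x (act a s))) ≡⟨ cong (act (neg a)) (push-cancel _ (inverseOf-invˡ x) (act-reduced a r)) ⟩
    act (neg a) (act a s)                         ≡⟨ act-neg-act a r ⟩
    s                                             ∎
    where open ≡-Reasoning

  act-act-neg : ∀ a {s} → Reduced s → act a (act (neg a) s) ≡ s
  act-act-neg []      _ = refl
  act-act-neg (x ∷ a) {s} r = begin
    push x (act a (act (neg (x ∷ a)) s))          ≡⟨ cong (λ b → push x (act a (act b s))) (neg-∷ x a) ⟩
    push x (act a (act (neg a ++ [ inv x ]) s))   ≡⟨ cong (push x ∘′ act a) (act-++ (neg a) [ inv x ] s) ⟩
    push x (act a (act (neg a) (push (inv x) s))) ≡⟨ cong (push x) (act-act-neg a (push-reduced (inv x) s r)) ⟩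
    push x (push (inv x) s)                       ≡⟨ push-cancel-inv x r ⟩
    s                                             ∎
    where open ≡-Reasoning

  neg-cong : ∀ {a b} → a ≈ b → neg a ≈ neg b
  neg-cong {a} {b} a≈b = mk≈ λ s r →
    let r′ = act-reduced (neg b) r in begin
    act (neg a) s                       ≡⟨ cong (act (neg a)) (act-act-neg b r) ⟨
    act (neg a) (act b (act (neg b) s)) ≡⟨ cong (act (neg a)) (act-≡ a≈b _ r′) ⟨
    act (neg a) (act a (act (neg b) s)) ≡⟨ act-neg-act a r′ ⟩
    act (neg b) s                       ∎
    where open ≡-Reasoning

  ++-neg : ∀ a → a ++ neg a ≈ []
  ++-neg a = mk≈ λ s r → trans (act-++ a (neg a) s) (act-act-neg a r)

  ∷-inv-cancel : ∀ x w → x ∷ inv x ∷ w ≈ w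
  ∷-inv-cancel x w = mk≈ λ s r → push-cancel-inv x (act-reduced w r)

  conj : Word N → Word N → Word N
  conj c x = c ++ (x ++ neg c)

  act-conj : ∀ c x s → act (conj c x) s ≡ act c (act x (act (neg c) s))
  act-conj c x s = trans (act-++ c _ s) (cong (act c) (act-++ x (neg c) s))

  conj-cong : ∀ c {x y} → x ≈ y → conj c x ≈ conj c y
  conj-cong c x≈y = ++-cong (≈-refl {c}) (++-cong x≈y (≈-refl {neg c}))

  conj-[] : ∀ c → conj c [] ≈ []
  conj-[] = ++-neg

  conj-++ : ∀ c x y → conj c x ++ conj c y ≈ conj c (x ++ y)
  conj-++ c x y = mk≈ λ s r →
    let r′ = act-reduced y (act-reduced (neg c) r) in begin
    act (conj c x ++ conj c y) s                              ≡⟨ act-++ (conj c x) _ s ⟩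
    act (conj c x) (act (conj c y) s)                         ≡⟨ act-conj c x _ ⟩
    act c (act x (act (neg c) (act (conj c y) s)))            ≡⟨ cong (act c ∘′ act x ∘′ act (neg c)) (act-conj c y s) ⟩
    act c (act x (act (neg c) (act c (act y (act (neg c) s))))) ≡⟨ cong (act c ∘′ act x) (act-neg-act c r′) ⟩
    act c (act x (act y (act (neg c) s)))                     ≡⟨ cong (act c) (act-++ x y _) ⟨
    act c (act (x ++ y) (act (neg c) s))                      ≡⟨ act-conj c (x ++ y) s ⟨
    act (conj c (x ++ y)) s                                   ∎
    where open ≡-Reasoning

  conj-neg-conj : ∀ c x → conj (neg c) (conj c x) ≈ x
  conj-neg-conj c x = mk≈ λ s r →
    let r′ = act-reduced (neg (neg c)) r in begin
    act (conj (neg c) (conj c x)) s                                   ≡⟨ act-conj (neg c) (conj c x) s ⟩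
    act (neg c) (act (conj c x) (act (neg (neg c)) s))                ≡⟨ cong (act (neg c)) (act-conj c x _) ⟩
    act (neg c) (act c (act x (act (neg c) (act (neg (neg c)) s))))   ≡⟨ act-neg-act c (act-reduced x (act-reduced (neg c) r′)) ⟩
    act x (act (neg c) (act (neg (neg c)) s))                         ≡⟨ cong (act x) (act-act-neg (neg c) r) ⟩
    act x s                                                           ∎
    where open ≡-Reasoning

  conj-conj-neg : ∀ c x → conj c (conj (neg c) x) ≈ x
  conj-conj-neg c x = mk≈ λ s r →
    let r′ = act-reduced (neg c) r in begin
    act (conj c (conj (neg c) x)) s                                   ≡⟨ act-conj c (conj (neg c) x) s ⟩
    act c (act (conj (neg c) x) (act (neg c) s))                      ≡⟨ cong (act c) (act-conj (neg c) x _) ⟩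
    act c (act (neg c) (act x (act (neg (neg c)) (act (neg c) s))))   ≡⟨ act-act-neg c (act-reduced x (act-reduced (neg (neg c)) r′)) ⟩
    act x (act (neg (neg c)) (act (neg c) s))                         ≡⟨ cong (act x) (act-neg-act (neg c) r) ⟩
    act x s                                                           ∎
    where open ≡-Reasoning

  conj-≈[]⁺ : ∀ c {x} → x ≈ [] → conj c x ≈ []
  conj-≈[]⁺ c x≈[] = ≈-trans (conj-cong c x≈[]) (conj-[] c)

  conj-≈[]⁻ : ∀ c {x} → conj c x ≈ [] → x ≈ []
  conj-≈[]⁻ c {x} cx≈[] = begin
    x                            ≈⟨ conj-neg-conj c x ⟨
    conj (neg c) (conj c x)      ≈⟨ conj-≈[]⁺ (neg c) cx≈[] ⟩
    []                           ∎
    where open ≈-Reasoning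

  Commute : Word N → Word N → Set
  Commute a b = a ++ b ≈ b ++ a

  Commute-respˡ : ∀ {a a′ b} → a ≈ a′ → Commute a b → Commute a′ b
  Commute-respˡ {a} {a′} {b} a≈a′ ab≈ba = begin
    a′ ++ b ≈⟨ ++-cong a≈a′ ≈-refl ⟨
    a ++ b  ≈⟨ ab≈ba ⟩
    b ++ a  ≈⟨ ++-cong ≈-refl a≈a′ ⟩
    b ++ a′ ∎
    where open ≈-Reasoning

  Commute-respʳ : ∀ {a b b′} → b ≈ b′ → Commute a b → Commute a b′
  Commute-respʳ b≈b′ ab≈ba = ≈-sym (Commute-respˡ b≈b′ (≈-sym ab≈ba))

  Commute-conj : ∀ c {a b} → Commute a b → Commute (conj c a) (conj c b)
  Commute-conj c {a} {b} ab≈ba = begin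
    conj c a ++ conj c b ≈⟨ conj-++ c a b ⟩
    conj c (a ++ b)      ≈⟨ conj-cong c ab≈ba ⟩
    conj c (b ++ a)      ≈⟨ conj-++ c b a ⟨
    conj c b ++ conj c a ∎
    where open ≈-Reasoning

  Commute-neg : ∀ {u v} → Commute u v → Commute (neg u) v
  Commute-neg {u} {v} uv≈vu = mk≈ λ s r →
    let t = act (neg u) s ; rt = act-reduced (neg u) r in begin
    act (neg u ++ v) s          ≡⟨ act-++ (neg u) v s ⟩
    act (neg u) (act v s)       ≡⟨ cong (act (neg u) ∘′ act v) (act-act-neg u r) ⟨
    act (neg u) (act v (act u t)) ≡⟨ cong (act (neg u)) (act-++ v u t) ⟨
    act (neg u) (act (v ++ u) t)  ≡⟨ cong (act (neg u)) (act-≡ uv≈vu t rt) ⟨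
    act (neg u) (act (u ++ v) t)  ≡⟨ cong (act (neg u)) (act-++ u v t) ⟩
    act (neg u) (act u (act v t)) ≡⟨ act-neg-act u (act-reduced v rt) ⟩
    act v t                     ≡⟨ act-++ v (neg u) s ⟨
    act (v ++ neg u) s          ∎
    where open ≡-Reasoning

  act-comm : ∀ a b s → act (comm a b) s ≡ act a (act b (act (neg a) (act (neg b) s)))
  act-comm a b s = trans (act-++ ((a ++ b) ++ neg a) (neg b) s)
    (trans (act-++ (a ++ b) (neg a) _) (act-++ a b _))

  comm≈[]⇒Commute : ∀ {a b} → comm a b ≈ [] → Commute a b
  comm≈[]⇒Commute {a} {b} comm≈[] = mk≈ λ s r →
    let t = act (b ++ a) s ; rt = act-reduced (b ++ a) r in begin
    act (a ++ b) s
      ≡⟨ act-++ a b s ⟩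
    act a (act b s)
      ≡⟨ cong (act a ∘′ act b) (act-neg-act a r) ⟨
    act a (act b (act (neg a) (act a s)))
      ≡⟨ cong (act a ∘′ act b ∘′ act (neg a)) (act-neg-act b (act-reduced a r)) ⟨
    act a (act b (act (neg a) (act (neg b) (act b (act a s)))))
      ≡⟨ act-comm a b (act b (act a s)) ⟨
    act (comm a b) (act b (act a s))
      ≡⟨ cong (act (comm a b)) (act-++ b a s) ⟨
    act (comm a b) t
      ≡⟨ act-≡ comm≈[] t rt ⟩
    t ∎
    where open ≡-Reasoning

  comm-cong : ∀ {a a′ b b′} → a ≈ a′ → b ≈ b′ → comm a b ≈ comm a′ b′
  comm-cong a≈a′ b≈b′ = ++-cong (++-cong (++-cong a≈a′ b≈b′) (neg-cong a≈a′)) (neg-cong b≈b′)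

  comm-≈[]ˡ : ∀ {a} b → a ≈ [] → comm a b ≈ []
  comm-≈[]ˡ b a≈[] = ≈-trans (comm-cong a≈[] (≈-refl {b}))
    (≈-trans (≡⇒≈ (cong (_++ neg b) (++-identityʳ b))) (++-neg b))

  comm-≈[]ʳ : ∀ a {b} → b ≈ [] → comm a b ≈ []
  comm-≈[]ʳ a b≈[] = ≈-trans (comm-cong (≈-refl {a}) b≈[])
    (≈-trans (≡⇒≈ (trans (++-identityʳ _) (cong (_++ neg a) (++-identityʳ a)))) (++-neg a))

  -- Restriction of nails

  restrict-++ : ∀ S (a b : Word N) → restrict S (a ++ b) ≡ restrict S a ++ restrict S b
  restrict-++ S []            b = refl
  restrict-++ S ((i , s) ∷ a) b with lookup S i
  ... | true  = restrict-++ S a b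
  ... | false = cong ((i , s) ∷_) (restrict-++ S a b)

  restrict-[inv] : ∀ S (x : Letter N) → restrict S [ inv x ] ≡ neg (restrict S [ x ])
  restrict-[inv] S (i , s) with lookup S i
  ... | true  = refl
  ... | false = refl

  restrict-neg : ∀ S (a : Word N) → restrict S (neg a) ≡ neg (restrict S a)
  restrict-neg S []      = refl
  restrict-neg S (x ∷ a) = begin
    restrict S (neg (x ∷ a))                      ≡⟨ cong (restrict S) (neg-∷ x a) ⟩
    restrict S (neg a ++ [ inv x ])               ≡⟨ restrict-++ S (neg a) [ inv x ] ⟩
    restrict S (neg a) ++ restrict S [ inv x ]    ≡⟨ cong₂ _++_ (restrict-neg S a) (restrict-[inv] S x) ⟩
    neg (restrict S a) ++ neg (restrict S [ x ])  ≡⟨ neg-++ (restrict S [ x ]) (restrict S a) ⟨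
    neg (restrict S [ x ] ++ restrict S a)        ≡⟨ cong neg (restrict-++ S [ x ] a) ⟨
    neg (restrict S (x ∷ a))                      ∎
    where open ≡-Reasoning

  restrict-conj : ∀ S (c x : Word N) → restrict S (conj c x) ≡ conj (restrict S c) (restrict S x)
  restrict-conj S c x = begin
    restrict S (c ++ (x ++ neg c))                       ≡⟨ restrict-++ S c _ ⟩
    restrict S c ++ restrict S (x ++ neg c)              ≡⟨ cong (restrict S c ++_) (restrict-++ S x (neg c)) ⟩
    restrict S c ++ (restrict S x ++ restrict S (neg c)) ≡⟨ cong (λ y → restrict S c ++ (restrict S x ++ y)) (restrict-neg S c) ⟩
    conj (restrict S c) (restrict S x)                   ∎
    where open ≡-Reasoning

  restrict-comm : ∀ S (a b : Word N) → restrict S (comm a b) ≡ comm (restrict S a) (restrict S b)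
  restrict-comm S a b
    rewrite restrict-++ S ((a ++ b) ++ neg a) (neg b) | restrict-++ S (a ++ b) (neg a) | restrict-++ S a b
          | restrict-neg S a | restrict-neg S b = refl

  restrict-push : ∀ S x (r : Word N) → restrict S (x ∷ r) ≈ restrict S (push x r)
  restrict-push S x []      = ≈-refl
  restrict-push S x (y ∷ r) with inverseOf x y in e
  ... | false = ≈-refl
  ... | true with inverseOf⇒≡inv x y e
  restrict-push S (i , s) (_ ∷ r) | true | refl with lookup S i in e
  ... | true  rewrite e = ≈-refl
  ... | false rewrite e = ∷-inv-cancel (i , s) (restrict S r)

  restrict-reduce : ∀ S (a : Word N) → restrict S a ≈ restrict S (reduce a)
  restrict-reduce S []      = ≈-refl
  restrict-reduce S (x ∷ a) = begin
    restrict S (x ∷ a)                    ≡⟨ restrict-++ S [ x ] a ⟩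
    restrict S [ x ] ++ restrict S a          ≈⟨ ++-cong (≈-refl {restrict S [ x ]}) (restrict-reduce S a) ⟩
    restrict S [ x ] ++ restrict S (reduce a) ≡⟨ restrict-++ S [ x ] (reduce a) ⟨
    restrict S (x ∷ reduce a)             ≈⟨ restrict-push S x (reduce a) ⟩
    restrict S (push x (reduce a))        ∎
    where open ≈-Reasoning

  restrict-cong : ∀ S {a b : Word N} → a ≈ b → restrict S a ≈ restrict S b
  restrict-cong S {a} {b} a≈b = begin
    restrict S a          ≈⟨ restrict-reduce S a ⟩
    restrict S (reduce a) ≡⟨ cong (restrict S) (≈⇒reduce≡ a≈b) ⟩
    restrict S (reduce b) ≈⟨ restrict-reduce S b ⟨
    restrict S b          ∎
    where open ≈-Reasoning

  restrict-⊆ : ∀ {S T} → S ⊆ T → (a : Word N) → restrict T (restrict S a) ≡ restrict T a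
  restrict-⊆ S⊆T [] = refl
  restrict-⊆ {S} {T} S⊆T ((i , s) ∷ a) with lookup S i in eS
  ... | false = restrict-⊆-∷
    where
      restrict-⊆-∷ : restrict T ((i , s) ∷ restrict S a) ≡ restrict T ((i , s) ∷ a)
      restrict-⊆-∷ with lookup T i
      ... | true  = restrict-⊆ S⊆T a
      ... | false = cong ((i , s) ∷_) (restrict-⊆ S⊆T a)
  ... | true rewrite []=⇒lookup (S⊆T (lookup⇒[]= i S eS)) = restrict-⊆ S⊆T a

  IsOn-neg : ∀ {U} {a : Word N} → IsOn U a → IsOn U (neg a)
  IsOn-neg {a = a} on = ↭ₚ.All-resp-↭ (↭-sym (↭ₚ.↭-reverse _)) (Allₚ.map⁺ on)

  IsOn-comm : ∀ {U} {a b : Word N} → IsOn U a → IsOn U b → IsOn U (comm a b)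
  IsOn-comm onA onB = Allₚ.++⁺ (Allₚ.++⁺ (Allₚ.++⁺ onA onB) (IsOn-neg onA)) (IsOn-neg onB)

  IsOn-huffman : ∀ {U} {xs} {w : Word N} → Huffman xs w → All (IsOn U) xs → IsOn U w
  IsOn-huffman done                  (onW ∷ []) = onW
  IsOn-huffman (step a b xs↭ _ _ h) onXs with ↭ₚ.All-resp-↭ xs↭ onXs
  ... | onA ∷ onB ∷ onRest = IsOn-huffman h (IsOn-comm onA onB ∷ onRest)

  IsOn-restrict : ∀ {U} S {a : Word N} → IsOn U a → IsOn U (restrict S a)
  IsOn-restrict S {[]}          []          = []
  IsOn-restrict S {(i , s) ∷ a} (i∈U ∷ on) with lookup S i
  ... | true  = IsOn-restrict S on
  ... | false = i∈U ∷ IsOn-restrict S on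

  restrict-∩ : ∀ S U {h : Word N} → IsOn U h → restrict S h ≡ restrict (S ∩ U) h
  restrict-∩ S U {[]}          []          = refl
  restrict-∩ S U {(i , s) ∷ h} (i∈U ∷ on)
    rewrite lookup-zipWith _∧_ i S U | []=⇒lookup i∈U | ∧-identityʳ (lookup S i) with lookup S i
  ... | true  = restrict-∩ S U on
  ... | false = cong ((i , s) ∷_) (restrict-∩ S U on)

  restrict-inside : ∀ S {h : Word N} → IsOn S h → restrict S h ≡ []
  restrict-inside S {[]}          []          = refl
  restrict-inside S {(i , s) ∷ h} (i∈S ∷ on) rewrite []=⇒lookup i∈S = restrict-inside S on

  restrict-outside : ∀ {U} S {h : Word N} → (∀ {x} → x ∈ U → x ∉ S) → IsOn U h → restrict S h ≡ h
  restrict-outside S {[]}          _   []          = refl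
  restrict-outside S {(i , s) ∷ h} U#S (i∈U ∷ on) with lookup S i in e
  ... | true  = ⊥-elim (U#S i∈U (lookup⇒[]= i S e))
  ... | false = cong ((i , s) ∷_) (restrict-outside S U#S on)

  ++-≈[]-disjoint : ∀ {L R} {x y : Word N} → (∀ {i} → i ∈ L → i ∉ R) → IsOn L x → IsOn R y →
                    x ++ y ≈ [] → x ≈ [] × y ≈ []
  ++-≈[]-disjoint {L} {R} {x} {y} L#R onX onY xy≈[] = x≈[] , y≈[]
    where
      x≈[] : x ≈ []
      x≈[] = subst (_≈ []) (begin
        restrict R (x ++ y)          ≡⟨ restrict-++ R x y ⟩
        restrict R x ++ restrict R y ≡⟨ cong₂ _++_ (restrict-outside R L#R onX) (restrict-inside R onY) ⟩
        x ++ []                      ≡⟨ ++-identityʳ x ⟩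
        x                            ∎) (restrict-cong R xy≈[])
        where open ≡-Reasoning
      y≈[] : y ≈ []
      y≈[] = subst (_≈ []) (begin
        restrict L (x ++ y)          ≡⟨ restrict-++ L x y ⟩
        restrict L x ++ restrict L y ≡⟨ cong₂ _++_ (restrict-inside L onX) (restrict-outside L (λ i∈R i∈L → L#R i∈L i∈R) onY) ⟩
        y                            ∎) (restrict-cong L xy≈[])
        where open ≡-Reasoning

  -- Commuting elements of a free group

  pow : Word N → ℕ → Word N
  pow z zero    = []
  pow z (suc n) = z ++ pow z n

  pow-+ : ∀ z m n → pow z m ++ pow z n ≡ pow z (m + n)
  pow-+ z zero    n = refl
  pow-+ z (suc m) n = trans (++-assoc z (pow z m) (pow z n)) (cong (z ++_) (pow-+ z m n))

  pow-cong : ∀ {z z′} n → z ≈ z′ → pow z n ≈ pow z′ n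
  pow-cong zero    _    = ≈-refl
  pow-cong (suc n) z≈z′ = ++-cong z≈z′ (pow-cong n z≈z′)

  pow-≈[] : ∀ {z} n → z ≈ [] → pow z n ≈ []
  pow-≈[] zero    _    = ≈-refl
  pow-≈[] (suc n) z≈[] = ++-cong z≈[] (pow-≈[] n z≈[])

  pow-conj : ∀ c r n → pow (conj c r) n ≈ conj c (pow r n)
  pow-conj c r zero    = ≈-sym (conj-[] c)
  pow-conj c r (suc n) = ≈-trans (++-cong ≈-refl (pow-conj c r n)) (conj-++ c r (pow r n))

  restrict-pow : ∀ S z n → restrict S (pow z n) ≡ pow (restrict S z) n
  restrict-pow S z zero    = refl
  restrict-pow S z (suc n) = trans (restrict-++ S z (pow z n)) (cong (restrict S z ++_) (restrict-pow S z n))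

  record CyclicForm (w : Word N) : Set where
    constructor cyclicForm
    field
      conjugator core : Word N
      w≡conj          : w ≡ conj conjugator core
      core-cyclic     : Reduced (core ++ core)
      core≢[]         : core ≢ []

  -- Cancelling first/last letter pairs x … x⁻¹ are peeled off into the conjugator.
  cyclic-form : ∀ n (w : Word N) → length w ≤ n → Reduced w → w ≢ [] → CyclicForm w
  cyclic-form n       []       _        _  w≢[] = ⊥-elim (w≢[] refl)
  cyclic-form (suc n) (x ∷ w₀) (s≤s le) rw _ with initLast w₀
  ... | [] = cyclicForm [] [ x ] refl (inverseOf-irrefl x , tt) (λ ())
  ... | m ∷ʳ′ y with inverseOf y x in eyx
  ...   | false = cyclicForm [] w (sym (++-identityʳ w)) ww (λ ())
    where
      w = x ∷ (m ++ [ y ])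
      ww : Reduced (w ++ w)
      ww = subst (Reduced ∘′ (x ∷_)) (sym (++-assoc m [ y ] w))
             (Reduced-glue (x ∷ m) [ y ] (λ ()) rw (eyx , rw))
  ...   | true with inverseOf⇒≡inv y x eyx | m
  ...     | refl | []     with () ← trans (sym (inverseOf-invˡ y)) (proj₁ rw)
  ...     | refl | z ∷ m′ = cyclicForm (inv y ∷ c) r (cong (inv y ∷_) m[y]≡) rr r≢[]
    where
      |m|≤n : length (z ∷ m′) ≤ n
      |m|≤n = ≤-trans (m≤n⇒m≤1+n ≤-refl) (subst (_≤ n) (trans (length-++ (z ∷ m′)) (+-comm _ 1)) le)
      open CyclicForm (cyclic-form n (z ∷ m′) |m|≤n (Reduced-++ˡ (z ∷ m′) (Reduced-tail x _ rw)) (λ ()))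
        renaming (conjugator to c; core to r; w≡conj to m≡; core-cyclic to rr; core≢[] to r≢[])
      m[y]≡ : (z ∷ m′) ++ [ y ] ≡ c ++ (r ++ neg (inv y ∷ c))
      m[y]≡ = begin
        (z ∷ m′) ++ [ y ]                       ≡⟨ cong (_++ [ y ]) m≡ ⟩
        (c ++ (r ++ neg c)) ++ [ y ]            ≡⟨ ++-assoc c _ _ ⟩
        c ++ ((r ++ neg c) ++ [ y ])            ≡⟨ cong (c ++_) (++-assoc r (neg c) [ y ]) ⟩
        c ++ (r ++ (neg c ++ [ y ]))            ≡⟨ cong (λ y′ → c ++ (r ++ (neg c ++ [ y′ ]))) (inv-involutive y) ⟨
        c ++ (r ++ (neg c ++ [ inv (inv y) ]))  ≡⟨ cong (λ t → c ++ (r ++ t)) (neg-∷ (inv y) c) ⟨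
        c ++ (r ++ neg (inv y ∷ c))             ∎
        where open ≡-Reasoning

  ≈[]⊎cyclicForm : (w : Word N) → w ≈ [] ⊎ CyclicForm (reduce w)
  ≈[]⊎cyclicForm w with reduce w in e
  ... | []    = inj₁ (reduce≡⇒≈ e)
  ... | x ∷ t = inj₂ (cyclic-form _ (x ∷ t) ≤-refl (subst Reduced e (reduce-reduced w)) (λ ()))

  Reduced-pow : ∀ {r t} → Reduced (r ++ r) → r ≢ [] → Reduced (r ++ t) → ∀ n → Reduced (r ++ pow r n ++ t)
  Reduced-pow rr r≢[] rt zero = rt
  Reduced-pow {r} {t} rr r≢[] rt (suc n) = subst (Reduced ∘′ (r ++_)) (sym (++-assoc r (pow r n) t))
    (Reduced-glue r r r≢[] rr (Reduced-pow rr r≢[] rt n))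

  Reduced-conj-pow : ∀ c r → Reduced (conj c r) → Reduced (r ++ r) → r ≢ [] → ∀ n → Reduced (conj c (pow r (suc n)))
  Reduced-conj-pow c r rcr rr r≢[] n = subst (Reduced ∘′ (c ++_)) (sym (++-assoc r (pow r n) (neg c)))
    (Reduced-glue c r r≢[] (Reduced-++ˡ (c ++ r) (subst Reduced (sym (++-assoc c r (neg c))) rcr))
      (Reduced-pow rr r≢[] (Reduced-++ʳ c rcr) n))

  -- Torsion-freeness: if w = c r c⁻¹ with r cyclically reduced, c r^(p+1) c⁻¹ is reduced and nonempty.
  pow-≈[]⇒≈[] : ∀ w p → pow w (suc p) ≈ [] → w ≈ []
  pow-≈[]⇒≈[] w p wᵖ≈[] with ≈[]⊎cyclicForm w
  ... | inj₁ w≈[] = w≈[]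
  ... | inj₂ (cyclicForm c r w≡ rr r≢[]) = ⊥-elim (r≢[] (++-conicalˡ r _ (++-conicalˡ _ (neg c) (++-conicalʳ c _ X≡[]))))
    where
      X = conj c (pow r (suc p))
      X≈[] : X ≈ []
      X≈[] = begin
        X                        ≈⟨ pow-conj c r (suc p) ⟨
        pow (conj c r) (suc p)   ≡⟨ cong (λ u → pow u (suc p)) w≡ ⟨
        pow (reduce w) (suc p)   ≈⟨ pow-cong (suc p) (≈-reduce w) ⟨
        pow w (suc p)            ≈⟨ wᵖ≈[] ⟩
        []                       ∎
        where open ≈-Reasoning
      X≡[] : X ≡ []
      X≡[] = trans (sym (reduce-of-reduced (Reduced-conj-pow c r (subst Reduced w≡ (reduce-reduced w)) rr r≢[] p))) (≈⇒reduce≡ X≈[])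

  ++-prefix : ∀ (a : Word N) {c} b {d} → a ++ c ≡ b ++ d → length a ≤ length b → b ≡ a ++ drop (length a) b
  ++-prefix []      b       _ _        = refl
  ++-prefix (x ∷ a) (y ∷ b) e (s≤s le) with ∷-injective e
  ... | refl , e′ = cong (x ∷_) (++-prefix a b e′ le)

  PowersOfCommonWord : Word N → Word N → Set
  PowersOfCommonWord a b = ∃[ z ] ∃[ p ] ∃[ q ] a ≡ pow z p × b ≡ pow z q

  -- Lyndon–Schützenberger: strip the shorter word off the front of the longer one.
  mutual
    ++-comm⇒powers : ∀ n (a b : Word N) → length a + length b ≤ n → a ++ b ≡ b ++ a → PowersOfCommonWord a b
    ++-comm⇒powers n a b len e with length a ≤? length b
    ... | yes a≤b = ++-comm⇒powers-≤ n a b len a≤b e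
    ... | no  a≰b with ++-comm⇒powers-≤ n b a (subst (_≤ n) (+-comm (length a) _) len) (<⇒≤ (≰⇒> a≰b)) (sym e)
    ...   | z , q , p , b≡ , a≡ = z , p , q , a≡ , b≡

    ++-comm⇒powers-≤ : ∀ n (a b : Word N) → length a + length b ≤ n → length a ≤ length b → a ++ b ≡ b ++ a →
                       PowersOfCommonWord a b
    ++-comm⇒powers-≤ n       []      b _   _   _ = b , 0 , 1 , refl , sym (++-identityʳ b)
    ++-comm⇒powers-≤ (suc n) (x ∷ a) b len a≤b e
      with ++-comm⇒powers n (x ∷ a) b′ len′ e′
      where
        A  = x ∷ a
        b′ = drop (length A) b
        b≡ : b ≡ A ++ b′
        b≡ = ++-prefix A b e a≤b
        e′ : A ++ b′ ≡ b′ ++ A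
        e′ = ++-cancelˡ A _ _ (begin
          A ++ (A ++ b′) ≡⟨ cong (A ++_) b≡ ⟨
          A ++ b         ≡⟨ e ⟩
          b ++ A         ≡⟨ cong (_++ A) b≡ ⟩
          (A ++ b′) ++ A ≡⟨ ++-assoc A b′ A ⟩
          A ++ (b′ ++ A) ∎)
          where open ≡-Reasoning
        len′ : length A + length b′ ≤ n
        len′ = subst (_≤ n) (trans (cong length b≡) (length-++ A)) (m+n≤o⇒n≤o (length a) (≤-pred len))
    ... | z , p , q , A≡ , b′≡ = z , p , p + q , A≡ , trans (++-prefix (x ∷ a) b e a≤b)
                                   (trans (cong₂ _++_ A≡ b′≡) (pow-+ z p q))

  ++-comm-restrict-≈[] : ∀ S {a b : Word N} → a ≢ [] → a ++ b ≡ b ++ a → restrict S a ≈ [] → restrict S b ≈ []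
  ++-comm-restrict-≈[] S {a} {b} a≢[] e Sa≈[] with ++-comm⇒powers _ a b ≤-refl e
  ... | z , zero  , q , refl , _    = ⊥-elim (a≢[] refl)
  ... | z , suc p , q , refl , refl = begin
    restrict S (pow z q)  ≡⟨ restrict-pow S z q ⟩
    pow (restrict S z) q  ≈⟨ pow-≈[] q (pow-≈[]⇒≈[] (restrict S z) p (subst (_≈ []) (restrict-pow S z (suc p)) Sa≈[])) ⟩
    []                    ∎
    where open ≈-Reasoning

  last-view : (w : Word N) → w ≢ [] → ∃₂ λ m y → w ≡ m ++ [ y ]
  last-view w w≢[] with initLast w
  ... | []      = ⊥-elim (w≢[] refl)
  ... | m ∷ʳ′ y = m , y , refl

  Commute-reduced⇒≡ : ∀ {a b : Word N} → Reduced (a ++ b) → Commute a b → a ++ b ≡ b ++ a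
  Commute-reduced⇒≡ {a} {b} rab ab≈ba = sym (reduced-≈⇒≡ rab (≈-sym ab≈ba) (length-++-comm b a))

  -- As u u is reduced, u v or u⁻¹ v is reduced, and a reduced product that commutes in the
  -- group commutes as a word, having the same length as its reversed product.
  cyclic-Commute⇒≡ : ∀ {u v} → Reduced (u ++ u) → Reduced v → Commute u v →
                     u ++ v ≡ v ++ u ⊎ neg u ++ v ≡ v ++ neg u
  cyclic-Commute⇒≡ {[]}    {v}     _   _  _ = inj₁ (sym (++-identityʳ v))
  cyclic-Commute⇒≡ {u}     {[]}    _   _  _ = inj₁ (++-identityʳ u)
  cyclic-Commute⇒≡ {h ∷ t} {y ∷ v} ruu rv uv≈vu with last-view (h ∷ t) (λ ())
  ... | m , x , u≡ with inverseOf x y in exy | inverseOf (inv h) y in ehy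
  ... | false | _ = inj₁ (Commute-reduced⇒≡ {h ∷ t} ruv uv≈vu)
    where
      ruv : Reduced ((h ∷ t) ++ y ∷ v)
      ruv = subst (λ u → Reduced (u ++ y ∷ v)) (sym u≡)
        (subst Reduced (sym (++-assoc m [ x ] (y ∷ v)))
          (Reduced-glue m [ x ] (λ ()) (subst Reduced u≡ (Reduced-++ˡ (h ∷ t) ruu)) (exy , rv)))
  ... | true | false = inj₂ (Commute-reduced⇒≡ {neg (h ∷ t)} rnuv (Commute-neg {h ∷ t} uv≈vu))
    where
      rnuv : Reduced (neg (h ∷ t) ++ y ∷ v)
      rnuv = subst (λ u → Reduced (u ++ y ∷ v)) (sym (neg-∷ h t))
        (subst Reduced (sym (++-assoc (neg t) [ inv h ] (y ∷ v)))
          (Reduced-glue (neg t) [ inv h ] (λ ())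
            (subst Reduced (neg-∷ h t) (Reduced-neg (h ∷ t) (Reduced-++ˡ (h ∷ t) ruu))) (ehy , rv)))
  ... | true | true = ⊥-elim impossible
    where
      h≡invx : h ≡ inv x
      h≡invx = trans (sym (trans (inverseOf⇒≡inv (inv h) y ehy) (inv-involutive h))) (inverseOf⇒≡inv x y exy)
      x-cancels-h : inverseOf x h ≡ true
      x-cancels-h = trans (cong (inverseOf x) h≡invx) (inverseOf-inv x)
      uu≡ : (h ∷ t) ++ (h ∷ t) ≡ m ++ x ∷ h ∷ t
      uu≡ = trans (cong (_++ (h ∷ t)) u≡) (++-assoc m [ x ] (h ∷ t))
      impossible : ⊥
      impossible with () ← trans (sym x-cancels-h) (proj₁ (Reduced-++ʳ m (subst Reduced uu≡ ruu)))

  cyclic-Commute-restrict-≈[] : ∀ S {r v : Word N} → Reduced (r ++ r) → r ≢ [] → Commute r v →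
                                restrict S r ≈ [] → restrict S v ≈ []
  cyclic-Commute-restrict-≈[] S {r} {v} rr r≢[] rv≈vr Sr≈[] = begin
    restrict S v          ≈⟨ restrict-cong S (≈-reduce v) ⟩
    restrict S (reduce v) ≈⟨ Sv̂≈[] ⟩
    []                    ∎
    where
      open ≈-Reasoning
      Sv̂≈[] : restrict S (reduce v) ≈ []
      Sv̂≈[] with cyclic-Commute⇒≡ rr (reduce-reduced v) (Commute-respʳ (≈-reduce v) rv≈vr)
      ... | inj₁ e = ++-comm-restrict-≈[] S r≢[] e Sr≈[]
      ... | inj₂ e = ++-comm-restrict-≈[] S (neg-≢[] r≢[]) e
                       (≈-trans (≡⇒≈ (restrict-neg S r)) (neg-cong Sr≈[]))

  Commute-restrict-≈[] : ∀ S {u v : Word N} → Commute u v → ¬ u ≈ [] → restrict S u ≈ [] → restrict S v ≈ []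
  Commute-restrict-≈[] S {u} {v} uv≈vu u≉[] Su≈[] with ≈[]⊎cyclicForm u
  ... | inj₁ u≈[] = ⊥-elim (u≉[] u≈[])
  ... | inj₂ (cyclicForm g r u≡ rr r≢[]) = begin
    restrict S v                          ≈⟨ restrict-cong S (conj-conj-neg g v) ⟨
    restrict S (conj g v′)                ≡⟨ restrict-conj S g v′ ⟩
    conj (restrict S g) (restrict S v′)   ≈⟨ conj-≈[]⁺ (restrict S g) (cyclic-Commute-restrict-≈[] S rr r≢[] rv′≈v′r Sr≈[]) ⟩
    []                                    ∎
    where
      open ≈-Reasoning
      v′ = conj (neg g) v
      u≈gr : u ≈ conj g r
      u≈gr = ≈-trans (≈-reduce u) (≡⇒≈ u≡)
      rv′≈v′r : Commute r v′
      rv′≈v′r = Commute-respˡ (≈-trans (conj-cong (neg g) u≈gr) (conj-neg-conj g r)) (Commute-conj (neg g) uv≈vu)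
      Sr≈[] : restrict S r ≈ []
      Sr≈[] = conj-≈[]⁻ (restrict S g) (begin
        conj (restrict S g) (restrict S r) ≡⟨ restrict-conj S g r ⟨
        restrict S (conj g r)              ≈⟨ restrict-cong S u≈gr ⟨
        restrict S u                       ≈⟨ Su≈[] ⟩
        []                                 ∎)

-- Counting nails and indices

Unique-++⇒Disjoint : ∀ (xs : List ℕ) {ys} → Unique (xs ++ ys) → Disjoint xs ys
Unique-++⇒Disjoint (x ∷ xs) (x∉ ∷ _) (here refl , v∈ys) = All.lookup x∉ (∈-++⁺ʳ xs v∈ys) refl
Unique-++⇒Disjoint (x ∷ xs) (_ ∷ u)  (there v∈xs , v∈ys) = Unique-++⇒Disjoint xs u (v∈xs , v∈ys)

Unique-resp-↭ : ∀ {xs ys : List ℕ} → xs ↭ ys → Unique xs → Unique ys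
Unique-resp-↭ xs↭ys = ↭ₛ.Unique-resp-↭ (setoid ℕ) (↭⇒↭ₛ xs↭ys)

least : ∀ x xs → ∃[ m ] m ∈ₗ x ∷ xs × All (m ≤_) (x ∷ xs)
least x xs = min x xs , [ here , there ]′ (argmin-sel id x xs) , min≤⊤ x xs ∷ min≤xs x xs

greatest : ∀ x xs → ∃[ m ] m ∈ₗ x ∷ xs × All (_≤ m) (x ∷ xs)
greatest x xs = max x xs , [ here , there ]′ (argmax-sel id x xs) , v≤max⁺ x xs (inj₁ ≤-refl) ∷ xs≤max x xs

m<n∸o⇒o+m<n : ∀ o {m n} → m < n ∸ o → o + m < n
m<n∸o⇒o+m<n zero              m<n   = m<n
m<n∸o⇒o+m<n (suc o) {n = suc n} m<n∸o = s≤s (m<n∸o⇒o+m<n o m<n∸o)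

-- `range` from Defs carries an implicit nail count N that it does not use.
module _ {N : ℕ} where

  ∈-range⁺ : ∀ {lo hi j} → lo ≤ j → j ≤ hi → j ∈ₗ range {N} lo hi
  ∈-range⁺ {lo} {hi} {j} lo≤j j≤hi = subst (_∈ₗ range {N} lo hi) (m+[n∸m]≡n lo≤j)
    (∈-map⁺ (lo +_) (∈-upTo⁺ (subst (_≤ suc hi ∸ lo) (+-∸-assoc 1 lo≤j) (∸-monoˡ-≤ lo (s≤s j≤hi)))))

  ∈-range⁻ : ∀ {lo hi j} → j ∈ₗ range {N} lo hi → lo ≤ j × j ≤ hi
  ∈-range⁻ {lo} j∈range with ∈-map⁻ (lo +_) j∈range
  ... | i , i∈upTo , refl = m≤m+n lo i , ≤-pred (m<n∸o⇒o+m<n lo (∈-upTo⁻ i∈upTo))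

  range-unique : ∀ lo hi → Unique (range {N} lo hi)
  range-unique lo hi = Uniqueₚ.map⁺ (+-cancelˡ-≡ lo _ _) (Uniqueₚ.upTo⁺ _)

Falls : ℕ → ℕ → ℕ → ℕ → Set
Falls k a b j = j ≤ a × k ∸ j ≤ b

Feasible : ℕ → ℕ → ℕ → ℕ → Set
Feasible k n₁ n₂ j = j ≤ k × j ≤ n₁ × k ∸ j ≤ n₂

record CountIsolation (k n₁ n₂ a b : ℕ) (J : List ℕ) : Set where
  field
    a′ b′ j₀      : ℕ
    a≤a′          : a ≤ a′
    a′≤n₁         : a′ ≤ n₁
    b≤b′          : b ≤ b′
    b′≤n₂         : b′ ≤ n₂
    j₀∈J          : j₀ ∈ₗ J
    j₀-falls      : Falls k a′ b′ j₀
    only-j₀-falls : ∀ {j} → j ∈ₗ J → Falls k a′ b′ j → j ≡ j₀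

-- If no index of J is at most a, raise a to the least index of J; otherwise raise b just
-- enough for the greatest index that is at most a.
isolate-counts : ∀ {k n₁ n₂ a b J} → a ≤ n₁ → b ≤ n₂ → J ≢ [] → All (Feasible k n₁ n₂) J →
                 ¬ Any (Falls k a b) J → CountIsolation k n₁ n₂ a b J
isolate-counts {J = []} _ _ J≢[] _ _ = ⊥-elim (J≢[] refl)
isolate-counts {k} {n₁} {n₂} {a} {b} {x ∷ xs} a≤n₁ b≤n₂ _ feasible ¬falls with filter (_≤? a) (x ∷ xs) in eq
... | [] = record
  { a≤a′ = <⇒≤ (a<J j₀∈J) ; a′≤n₁ = proj₁ (proj₂ j₀-feasible)
  ; b≤b′ = m≤m⊔n b (k ∸ j₀) ; b′≤n₂ = ⊔-lub b≤n₂ (proj₂ (proj₂ j₀-feasible))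
  ; j₀∈J = j₀∈J ; j₀-falls = ≤-refl , m≤n⊔m b (k ∸ j₀)
  ; only-j₀-falls = λ j∈J (j≤j₀ , _) → ≤-antisym j≤j₀ (All.lookup j₀≤J j∈J)
  }
  where
    a<J : ∀ {j} → j ∈ₗ x ∷ xs → a < j
    a<J {j} j∈J with j ≤? a
    ... | yes j≤a with () ← subst (j ∈ₗ_) eq (∈-filter⁺ (_≤? a) j∈J j≤a)
    ... | no  j≰a = ≰⇒> j≰a
    j₀ = proj₁ (least x xs)
    j₀∈J = proj₁ (proj₂ (least x xs))
    j₀≤J = proj₂ (proj₂ (least x xs))
    j₀-feasible = All.lookup feasible j₀∈J
... | f ∷ fs = record
  { a≤a′ = ≤-refl ; a′≤n₁ = a≤n₁
  ; b≤b′ = <⇒≤ (≰⇒> (¬falls ∘ lose j₀∈J ∘ (j₀≤a ,_))) ; b′≤n₂ = proj₂ (proj₂ j₀-feasible)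
  ; j₀∈J = j₀∈J ; j₀-falls = j₀≤a , ≤-refl
  ; only-j₀-falls = only
  }
  where
    j₀ = proj₁ (greatest f fs)
    j₀∈filter : j₀ ∈ₗ filter (_≤? a) (x ∷ xs)
    j₀∈filter = subst (j₀ ∈ₗ_) (sym eq) (proj₁ (proj₂ (greatest f fs)))
    j₀∈J : j₀ ∈ₗ x ∷ xs
    j₀∈J = proj₁ (∈-filter⁻ (_≤? a) {xs = x ∷ xs} j₀∈filter)
    j₀≤a : j₀ ≤ a
    j₀≤a = proj₂ (∈-filter⁻ (_≤? a) {xs = x ∷ xs} j₀∈filter)
    j₀-feasible = All.lookup feasible j₀∈J
    only : ∀ {j} → j ∈ₗ x ∷ xs → Falls k a (k ∸ j₀) j → j ≡ j₀
    only j∈J (j≤a , k∸j≤k∸j₀) = ≤-antisym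
      (All.lookup (proj₂ (proj₂ (greatest f fs))) (subst (_ ∈ₗ_) eq (∈-filter⁺ (_≤? a) j∈J j≤a)))
      (∸-cancelʳ-≤ (proj₁ j₀-feasible) k∸j≤k∸j₀)

some-index-falls : ∀ {k n₁ n₂ a b} → a ≤ n₁ → b ≤ n₂ → k ≤ a + b →
                   ∃[ j ] (k ∸ n₂ ≤ j × j ≤ k ⊓ n₁) × Falls k a b j
some-index-falls {k} {n₁} {n₂} {a} {b} a≤n₁ b≤n₂ k≤a+b = k ⊓ a , (lo≤j , ⊓-monoʳ-≤ k a≤n₁) , m⊓n≤n k a , k∸j≤b
  where
    lo≤j : k ∸ n₂ ≤ k ⊓ a
    lo≤j = ⊓-glb (m∸n≤m k n₂)
      (m≤n+o⇒m∸n≤o k n₂ (≤-trans k≤a+b (≤-trans (+-monoʳ-≤ a b≤n₂) (≤-reflexive (+-comm a n₂)))))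
    k∸j≤b : k ∸ (k ⊓ a) ≤ b
    k∸j≤b rewrite ∸-distribˡ-⊓-⊔ k k a | n∸n≡0 k = m≤n+o⇒m∸n≤o k a k≤a+b

range-feasible : ∀ {N k n₁ n₂ j} → j ∈ₗ range {N} (k ∸ n₂) (k ⊓ n₁) → Feasible k n₁ n₂ j
range-feasible {N} {k} {n₁} {n₂} {j} j∈range with ∈-range⁻ {N} j∈range
... | lo≤j , j≤hi = ≤-trans j≤hi (m⊓n≤m k n₁) , ≤-trans j≤hi (m⊓n≤n k n₁) ,
  m≤n+o⇒m∸n≤o k j (≤-trans (m≤n+m∸n k n₂) (≤-trans (+-monoʳ-≤ n₂ lo≤j) (≤-reflexive (+-comm n₂ j))))

fill : ∀ {n} (S U : Subset n) m → S ⊆ U → ∣ S ∣ ≤ m → m ≤ ∣ U ∣ → ∃[ T ] S ⊆ T × T ⊆ U × ∣ T ∣ ≡ m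
fill []          []          _       _   _         z≤n       = [] , id , id , refl
fill (true ∷ S)  (false ∷ U) _       S⊆U _         _         with () ← S⊆U here
fill (false ∷ S) (false ∷ U) m       S⊆U |S|≤m     m≤|U|     =
  let T , S⊆T , T⊆U , |T|≡m = fill S U m (drop-∷-⊆ S⊆U) |S|≤m m≤|U| in false ∷ T , s⊆s S⊆T , s⊆s T⊆U , |T|≡m
fill (true ∷ S)  (true ∷ U)  (suc m) S⊆U (s≤s |S|≤m) (s≤s m≤|U|) =
  let T , S⊆T , T⊆U , |T|≡m = fill S U m (drop-∷-⊆ S⊆U) |S|≤m m≤|U| in true ∷ T , s⊆s S⊆T , s⊆s T⊆U , cong suc |T|≡m
fill (false ∷ S) (true ∷ U)  m       S⊆U |S|≤m     m≤|U|     with ∣ S ∣ <? m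
fill (false ∷ S) (true ∷ U)  (suc m) S⊆U _         (s≤s m≤|U|) | yes (s≤s |S|≤m) =
  let T , S⊆T , T⊆U , |T|≡m = fill S U m (drop-∷-⊆ S⊆U) |S|≤m m≤|U| in true ∷ T , out⊆ S⊆T , s⊆s T⊆U , cong suc |T|≡m
... | no |S|≮m =
  let T , S⊆T , T⊆U , |T|≡m = fill S U m (drop-∷-⊆ S⊆U) |S|≤m
                                (≤-trans (≮⇒≥ |S|≮m) (p⊆q⇒∣p∣≤∣q∣ (drop-∷-⊆ S⊆U)))
  in false ∷ T , s⊆s S⊆T , out⊆ T⊆U , |T|≡m

[p∪q]∩r≡p : ∀ {n} {p q r s : Subset n} → (∀ {x} → x ∈ r → x ∉ s) → p ⊆ r → q ⊆ s → (p ∪ q) ∩ r ≡ p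
[p∪q]∩r≡p {p = p} {q} {r} r#s p⊆r q⊆s = ⊆-antisym [p∪q]∩r⊆p p⊆[p∪q]∩r
  where
    [p∪q]∩r⊆p : (p ∪ q) ∩ r ⊆ p
    [p∪q]∩r⊆p x∈ with x∈p∩q⁻ (p ∪ q) r x∈
    ... | x∈p∪q , x∈r with x∈p∪q⁻ p q x∈p∪q
    ...   | inj₁ x∈p = x∈p
    ...   | inj₂ x∈q = ⊥-elim (r#s x∈r (q⊆s x∈q))
    p⊆[p∪q]∩r : p ⊆ (p ∪ q) ∩ r
    p⊆[p∪q]∩r x∈p = x∈p∩q⁺ (p⊆p∪q q x∈p , p⊆r x∈p)

extend-to-counts : ∀ {n} {S L R : Subset n} → (∀ {x} → x ∈ L → x ∉ R) → S ⊆ L ∪ R → ∀ {a b} →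
  ∣ S ∩ L ∣ ≤ a → a ≤ ∣ L ∣ → ∣ S ∩ R ∣ ≤ b → b ≤ ∣ R ∣ →
  ∃[ T ] S ⊆ T × T ⊆ L ∪ R × ∣ T ∩ L ∣ ≡ a × ∣ T ∩ R ∣ ≡ b
extend-to-counts {S = S} {L} {R} L#R S⊆L∪R {a} {b} |S∩L|≤a a≤|L| |S∩R|≤b b≤|R| =
  TL ∪ TR , S⊆T , T⊆L∪R ,
  trans (cong ∣_∣ ([p∪q]∩r≡p L#R TL⊆L TR⊆R)) |TL|≡a ,
  trans (cong (∣_∣ ∘ (_∩ R)) (∪-comm TL TR))
    (trans (cong ∣_∣ ([p∪q]∩r≡p (λ x∈R x∈L → L#R x∈L x∈R) TR⊆R TL⊆L)) |TR|≡b)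
  where
    TL-fill = fill (S ∩ L) L a (p∩q⊆q S L) |S∩L|≤a a≤|L|
    TR-fill = fill (S ∩ R) R b (p∩q⊆q S R) |S∩R|≤b b≤|R|
    TL = proj₁ TL-fill
    TR = proj₁ TR-fill
    S∩L⊆TL = proj₁ (proj₂ TL-fill)
    TL⊆L   = proj₁ (proj₂ (proj₂ TL-fill))
    |TL|≡a = proj₂ (proj₂ (proj₂ TL-fill))
    S∩R⊆TR = proj₁ (proj₂ TR-fill)
    TR⊆R   = proj₁ (proj₂ (proj₂ TR-fill))
    |TR|≡b = proj₂ (proj₂ (proj₂ TR-fill))
    S⊆T : S ⊆ TL ∪ TR
    S⊆T x∈S with x∈p∪q⁻ L R (S⊆L∪R x∈S)
    ... | inj₁ x∈L = p⊆p∪q TR (S∩L⊆TL (x∈p∩q⁺ (x∈S , x∈L)))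
    ... | inj₂ x∈R = q⊆p∪q TL TR (S∩R⊆TR (x∈p∩q⁺ (x∈S , x∈R)))
    T⊆L∪R : TL ∪ TR ⊆ L ∪ R
    T⊆L∪R x∈T with x∈p∪q⁻ TL TR x∈T
    ... | inj₁ x∈TL = p⊆p∪q R (TL⊆L x∈TL)
    ... | inj₂ x∈TR = q⊆p∪q L R (TR⊆R x∈TR)

∣p∣≡∣p∩q∣+∣p∩r∣ : ∀ {n} (p q r : Subset n) → (∀ {x} → x ∈ q → x ∉ r) → p ⊆ q ∪ r →
                  ∣ p ∣ ≡ ∣ p ∩ q ∣ + ∣ p ∩ r ∣
∣p∣≡∣p∩q∣+∣p∩r∣ []      []      []      _   _ = refl
∣p∣≡∣p∩q∣+∣p∩r∣ (x ∷ p) (y ∷ q) (z ∷ r) q#r p⊆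
  with ∣p∣≡∣p∩q∣+∣p∩r∣ p q r (λ i∈q i∈r → q#r (there i∈q) (there i∈r)) (drop-∷-⊆ p⊆)
... | ih with x | y | z
...   | false | _     | _     = ih
...   | true  | true  | true  = ⊥-elim (q#r here here)
...   | true  | true  | false = cong suc ih
...   | true  | false | true  = trans (cong suc ih) (sym (+-suc _ _))
...   | true  | false | false with () ← p⊆ here

-- Solutions of k-out-of-n specifications

kof≡fall⇔ : ∀ {N} t (U S : Subset N) → kof t U S ≡ fall ⇔ t ≤ ∣ S ∣
kof≡fall⇔ t U S with t ≤ᵇ ∣ S ∣ in e
... | true  = mk⇔ (λ _ → ≤ᵇ⇒≤ t ∣ S ∣ (subst Bool.T (sym e) tt)) (λ _ → refl)
... | false = mk⇔ (λ ()) (λ t≤|S| → ⊥-elim (subst Bool.T e (≤⇒≤ᵇ t≤|S|)))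

family-vanishes : ∀ {N} {U : Subset N} {H} → SolutionFamily U H → ∀ {t} → 1 ≤ t → t ≤ ∣ U ∣ → ∀ S →
                  restrict S (H t) ≈ [] ⇔ t ≤ ∣ S ∩ U ∣
family-vanishes {U = U} {H} family {t} 1≤t t≤|U| S = begin
  restrict S (H t) ≈ []              ≡⟨ cong (_≈ []) (restrict-∩ S U (proj₁ (family t 1≤t t≤|U|))) ⟩
  restrict (S ∩ U) (H t) ≈ []        ≈⟨ IsZero⇔≈[] ⟨
  IsZero (restrict (S ∩ U) (H t))    ≈⟨ proj₂ (family t 1≤t t≤|U|) (S ∩ U) (p∩q⊆q S U) ⟩
  kof t U (S ∩ U) ≡ fall             ≈⟨ kof≡fall⇔ t U (S ∩ U) ⟩
  t ≤ ∣ S ∩ U ∣                      ∎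
  where open SetoidReasoning (⇔-setoid 0ℓ)

singleton-solves : ∀ {N} (v : Fin N) {k} → 1 ≤ k → k ≤ ∣ ⁅ v ⁆ ∣ →
                   IsOn ⁅ v ⁆ [ (v , true) ] × Solves ⁅ v ⁆ (kof k ⁅ v ⁆) [ (v , true) ]
singleton-solves {N} v {k} 1≤k k≤|⁅v⁆| = x∈⁅x⁆ v ∷ [] , solves
  where
    solves : Solves ⁅ v ⁆ (kof k ⁅ v ⁆) [ (v , true) ]
    solves S S⊆⁅v⁆ with lookup S v in e
    ... | true  = mk⇔ (λ _ → Equivalence.from (kof≡fall⇔ k ⁅ v ⁆ S) (≤-trans k≤|⁅v⁆| (p⊆q⇒∣p∣≤∣q∣ ⁅v⁆⊆S)))
                      (λ _ → refl)
      where
        ⁅v⁆⊆S : ⁅ v ⁆ ⊆ S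
        ⁅v⁆⊆S x∈⁅v⁆ rewrite x∈⁅y⁆⇒x≡y v x∈⁅v⁆ = lookup⇒[]= v S e
    ... | false = mk⇔ (λ ()) (λ f → ⊥-elim (1+n≰n (≤-trans 1≤k (≤-trans (Equivalence.to (kof≡fall⇔ k ⁅ v ⁆ S) f) |S|≤0))))
      where
        S⊆∅ : S ⊆ ∅
        S⊆∅ x∈S with x∈⁅y⁆⇒x≡y v (S⊆⁅v⁆ x∈S)
        ... | refl with () ← trans (sym ([]=⇒lookup x∈S)) e
        |S|≤0 : ∣ S ∣ ≤ 0
        |S|≤0 = subst (∣ S ∣ ≤_) (∣⊥∣≡0 N) (p⊆q⇒∣p∣≤∣q∣ S⊆∅)

-- Commutator trees

record Isolation {N : ℕ} (V : Subset N) (LeafFalls : ℕ → Subset N → Set) (J : List ℕ) (S : Subset N) : Set where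
  field
    T             : Subset N
    S⊆T           : S ⊆ T
    T⊆V           : T ⊆ V
    j₀            : ℕ
    j₀∈J          : j₀ ∈ₗ J
    j₀-falls      : LeafFalls j₀ T
    only-j₀-falls : ∀ {j} → j ∈ₗ J → LeafFalls j T → j ≡ j₀

module CommutatorTrees
  {N : ℕ} (V : Subset N) (LeafFalls : ℕ → Subset N → Set) (leafFalls? : ∀ j S → Dec (LeafFalls j S))
  (Admissible : ℕ → Set)
  (isolate : ∀ {J S} → J ≢ [] → All Admissible J → S ⊆ V → ¬ Any (λ j → LeafFalls j S) J → Isolation V LeafFalls J S)
  where

  VanishesIffFalls : Word N → List ℕ → Set
  VanishesIffFalls y J = ∀ S → S ⊆ V → restrict S y ≈ [] ⇔ Any (λ j → LeafFalls j S) J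

  commuting-parts-cannot-fall : ∀ {a b Ja Jb S} (T : Subset N) {j₀} →
    VanishesIffFalls a Ja → VanishesIffFalls b Jb → Disjoint Ja Jb → S ⊆ T → T ⊆ V →
    Commute (restrict S a) (restrict S b) → ¬ Any (λ j → LeafFalls j S) Ja →
    j₀ ∈ₗ Ja → LeafFalls j₀ T → (∀ {j} → j ∈ₗ Jb → LeafFalls j T → j ≡ j₀) → ⊥
  commuting-parts-cannot-fall {a} {b} {Ja} {Jb} {S} T va vb Ja#Jb S⊆T T⊆V ab≈ba ¬fallsˢ j₀∈Ja j₀-falls only-j₀
    with find (Equivalence.to (vb T T⊆V) Tb≈[])
    where
      Sa≉[] : ¬ restrict S a ≈ []
      Sa≉[] = ¬fallsˢ ∘ Equivalence.to (va S (T⊆V ∘ S⊆T))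
      Ta≈[] : restrict T a ≈ []
      Ta≈[] = Equivalence.from (va T T⊆V) (lose j₀∈Ja j₀-falls)
      Tb≈[] : restrict T b ≈ []
      Tb≈[] = subst (_≈ []) (restrict-⊆ S⊆T b)
        (Commute-restrict-≈[] T ab≈ba Sa≉[] (subst (_≈ []) (sym (restrict-⊆ S⊆T a)) Ta≈[]))
  ... | j , j∈Jb , j-falls with only-j₀ j∈Jb j-falls
  ...   | refl = Ja#Jb (j₀∈Ja , j∈Jb)

  comm-vanishes : ∀ {a b Ja Jb} → VanishesIffFalls a Ja → VanishesIffFalls b Jb →
    Ja ≢ [] → All Admissible Ja → All Admissible Jb → Disjoint Ja Jb →
    VanishesIffFalls (comm a b) (Ja ++ Jb)
  comm-vanishes {a} {b} {Ja} {Jb} va vb Ja≢[] admA admB Ja#Jb S S⊆V = mk⇔ to from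
    where
      from : Any (λ j → LeafFalls j S) (Ja ++ Jb) → restrict S (comm a b) ≈ []
      from falls with Any.++⁻ Ja falls
      ... | inj₁ fa = ≈-trans (≡⇒≈ (restrict-comm S a b)) (comm-≈[]ˡ (restrict S b) (Equivalence.from (va S S⊆V) fa))
      ... | inj₂ fb = ≈-trans (≡⇒≈ (restrict-comm S a b)) (comm-≈[]ʳ (restrict S a) (Equivalence.from (vb S S⊆V) fb))
      commute : restrict S (comm a b) ≈ [] → Commute (restrict S a) (restrict S b)
      commute Scomm≈[] = comm≈[]⇒Commute {a = restrict S a} {b = restrict S b} (≈-trans (≡⇒≈ (sym (restrict-comm S a b))) Scomm≈[])
      to : restrict S (comm a b) ≈ [] → Any (λ j → LeafFalls j S) (Ja ++ Jb)
      to Scomm≈[] with any? (λ j → leafFalls? j S) (Ja ++ Jb)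
      ... | yes falls = falls
      ... | no ¬falls with isolate (Ja≢[] ∘ ++-conicalˡ Ja Jb) (Allₚ.++⁺ admA admB) S⊆V ¬falls
      ...   | record { T = T ; S⊆T = S⊆T ; T⊆V = T⊆V ; j₀∈J = j₀∈J ; j₀-falls = j₀-falls ; only-j₀-falls = only }
            with ∈-++⁻ Ja j₀∈J
      ...     | inj₁ j₀∈Ja = ⊥-elim (commuting-parts-cannot-fall {a} {b} T va vb Ja#Jb S⊆T T⊆V (commute Scomm≈[])
                                (¬falls ∘ Any.++⁺ˡ) j₀∈Ja j₀-falls (only ∘ ∈-++⁺ʳ Ja))
      ...     | inj₂ j₀∈Jb = ⊥-elim (commuting-parts-cannot-fall {b} {a} T vb va (λ (x , y) → Ja#Jb (y , x)) S⊆T T⊆V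
                                (≈-sym (commute Scomm≈[])) (¬falls ∘ Any.++⁺ʳ Ja) j₀∈Jb j₀-falls (only ∘ ∈-++⁺ˡ))

  -- A piece is a subtree of the commutator tree together with the indices of its leaves.
  Piece : Set
  Piece = Word N × List ℕ

  labels : List Piece → List ℕ
  labels ps = concat (map proj₂ ps)

  Sound : Piece → Set
  Sound (y , J) = VanishesIffFalls y J × J ≢ [] × All Admissible J

  labels-↭ : ∀ {ps qs} → ps ↭ qs → labels ps ↭ labels qs
  labels-↭ ↭.refl                = ↭-refl
  labels-↭ (↭.prep p ps↭qs)      = ↭ₚ.++⁺ˡ (proj₂ p) (labels-↭ ps↭qs)
  labels-↭ (↭.swap p q ps↭qs)    = ↭-trans (↭ₚ.shifts (proj₂ p) (proj₂ q))
                                     (↭ₚ.++⁺ˡ (proj₂ q) (↭ₚ.++⁺ˡ (proj₂ p) (labels-↭ ps↭qs)))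
  labels-↭ (↭.trans ps↭qs qs↭rs) = ↭-trans (labels-↭ ps↭qs) (labels-↭ qs↭rs)

  huffman-vanishes : ∀ {xs w} → Huffman xs w → (ps : List Piece) → map proj₁ ps ↭ xs →
    All Sound ps → Unique (labels ps) → ∃[ J ] J ↭ labels ps × VanishesIffFalls w J
  huffman-vanishes done ps ps↭ sound _ with ↭ₚ.↭-map-inv proj₁ ps↭
  ... | (y , J) ∷ [] , refl , ps↭[p] with ↭ₚ.All-resp-↭ ps↭[p] sound
  ...   | (vJ , _) ∷ [] = J , ↭-sym (↭-trans (labels-↭ ps↭[p]) (↭-reflexive (++-identityʳ J))) , vJ
  huffman-vanishes (step a b xs↭ _ _ h) ps ps↭ sound uniq with ↭ₚ.↭-map-inv proj₁ (↭-trans ps↭ xs↭)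
  ... | (a , Ja) ∷ (b , Jb) ∷ rest , refl , ps↭′
      with ↭ₚ.All-resp-↭ ps↭′ sound | Unique-resp-↭ (labels-↭ ps↭′) uniq
  ...   | (va , Ja≢[] , admA) ∷ (vb , _ , admB) ∷ sound-rest | uniq′
      with huffman-vanishes h ((comm a b , Ja ++ Jb) ∷ rest) ↭-refl
             ((comm-vanishes {a} {b} va vb Ja≢[] admA admB Ja#Jb , Ja≢[] ∘ ++-conicalˡ Ja Jb , Allₚ.++⁺ admA admB) ∷ sound-rest)
             (subst Unique (sym (++-assoc Ja Jb (labels rest))) uniq′)
      where
        Ja#Jb : Disjoint Ja Jb
        Ja#Jb (j∈Ja , j∈Jb) = Unique-++⇒Disjoint Ja uniq′ (j∈Ja , ∈-++⁺ˡ j∈Jb)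
  ...     | J , J↭ , vJ = J , ↭-trans J↭ (↭-trans (↭-reflexive (++-assoc Ja Jb (labels rest))) (↭-sym (labels-↭ ps↭′))) , vJ

-- The splitting construction

module Construction {N : ℕ} (L R : Subset N) (L#R : ∀ {x} → x ∈ L → x ∉ R)
  (HL HR : ℕ → Word N) (familyL : SolutionFamily L HL) (familyR : SolutionFamily R HR)
  (k : ℕ) (1≤k : 1 ≤ k) where

  FallsAt : ℕ → Subset N → Set
  FallsAt j S = Falls k ∣ S ∩ L ∣ ∣ S ∩ R ∣ j

  isolate : ∀ {J S} → J ≢ [] → All (Feasible k ∣ L ∣ ∣ R ∣) J → S ⊆ L ∪ R → ¬ Any (λ j → FallsAt j S) J →
            Isolation (L ∪ R) FallsAt J S
  isolate {J} {S} J≢[] feasible S⊆V ¬falls = record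
    { T = T ; S⊆T = S⊆T ; T⊆V = T⊆V ; j₀ = j₀ ; j₀∈J = j₀∈J
    ; j₀-falls = subst₂ (λ a b → Falls k a b j₀) (sym |T∩L|≡a′) (sym |T∩R|≡b′) j₀-falls
    ; only-j₀-falls = λ j∈J falls → only-j₀-falls j∈J (subst₂ (λ a b → Falls k a b _) |T∩L|≡a′ |T∩R|≡b′ falls)
    }
    where
      open CountIsolation (isolate-counts (∣p∩q∣≤∣q∣ S L) (∣p∩q∣≤∣q∣ S R) J≢[] feasible ¬falls)
      extension = extend-to-counts L#R S⊆V a≤a′ a′≤n₁ b≤b′ b′≤n₂
      T = proj₁ extension
      S⊆T = proj₁ (proj₂ extension)
      T⊆V = proj₁ (proj₂ (proj₂ extension))
      |T∩L|≡a′ = proj₁ (proj₂ (proj₂ (proj₂ extension)))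
      |T∩R|≡b′ = proj₂ (proj₂ (proj₂ (proj₂ extension)))

  open CommutatorTrees (L ∪ R) FallsAt (λ j S → j ≤? ∣ S ∩ L ∣ ×-dec k ∸ j ≤? ∣ S ∩ R ∣)
                       (Feasible k ∣ L ∣ ∣ R ∣) isolate

  Dexpr-vanishes : ∀ {j} → Feasible k ∣ L ∣ ∣ R ∣ j → ∀ S → restrict S (Dexpr k HL HR j) ≈ [] ⇔ FallsAt j S
  Dexpr-vanishes {j} (j≤k , j≤|L| , k∸j≤|R|) S with j ≟ 0 | j ≟ k
  ... | yes refl | _ = mk⇔ (λ z → z≤n , Equivalence.to Rₖ z) (Equivalence.from Rₖ ∘ proj₂)
    where Rₖ = family-vanishes familyR 1≤k k∸j≤|R| S
  ... | no _ | yes refl =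
    mk⇔ (λ z → Equivalence.to Lₖ z , subst (_≤ ∣ S ∩ R ∣) (sym (n∸n≡0 k)) z≤n) (Equivalence.from Lₖ ∘ proj₁)
    where Lₖ = family-vanishes familyL 1≤k j≤|L| S
  ... | no j≢0 | no j≢k = mk⇔ to from
    where
      1≤j = n≢0⇒n>0 j≢0
      1≤k∸j = m<n⇒0<n∸m (≤∧≢⇒< j≤k j≢k)
      Lⱼ = family-vanishes familyL 1≤j j≤|L| S
      Rₖ₋ⱼ = family-vanishes familyR 1≤k∸j k∸j≤|R| S
      to : restrict S (HL j ++ HR (k ∸ j)) ≈ [] → FallsAt j S
      to z with ++-≈[]-disjoint L#R (IsOn-restrict S (proj₁ (familyL j 1≤j j≤|L|)))
                                    (IsOn-restrict S (proj₁ (familyR (k ∸ j) 1≤k∸j k∸j≤|R|)))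
                  (subst (_≈ []) (restrict-++ S (HL j) (HR (k ∸ j))) z)
      ... | zL , zR = Equivalence.to Lⱼ zL , Equivalence.to Rₖ₋ⱼ zR
      from : FallsAt j S → restrict S (HL j ++ HR (k ∸ j)) ≈ []
      from (fL , fR) = subst (_≈ []) (sym (restrict-++ S (HL j) (HR (k ∸ j))))
        (++-cong (Equivalence.from Lⱼ fL) (Equivalence.from Rₖ₋ⱼ fR))

  Dexpr-on : ∀ {j} → Feasible k ∣ L ∣ ∣ R ∣ j → IsOn (L ∪ R) (Dexpr k HL HR j)
  Dexpr-on {j} (j≤k , j≤|L| , k∸j≤|R|) with j ≟ 0 | j ≟ k
  ... | yes refl | _ = All.map (q⊆p∪q L R) (proj₁ (familyR k 1≤k k∸j≤|R|))
  ... | no _ | yes refl = All.map (p⊆p∪q R) (proj₁ (familyL k 1≤k j≤|L|))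
  ... | no j≢0 | no j≢k = Allₚ.++⁺ (All.map (p⊆p∪q R) (proj₁ (familyL j (n≢0⇒n>0 j≢0) j≤|L|)))
                                  (All.map (q⊆p∪q L R) (proj₁ (familyR (k ∸ j) (m<n⇒0<n∸m (≤∧≢⇒< j≤k j≢k)) k∸j≤|R|)))

  leaf : ℕ → Piece
  leaf j = Dexpr k HL HR j , [ j ]

  leaf-sound : ∀ {j} → Feasible k ∣ L ∣ ∣ R ∣ j → Sound (leaf j)
  leaf-sound feasible =
    (λ S _ → mk⇔ (Any.singleton⁺ ∘ Equivalence.to (Dexpr-vanishes feasible S))
                 (Equivalence.from (Dexpr-vanishes feasible S) ∘ Any.singleton⁻)) ,
    (λ ()) , feasible ∷ []

  indices : List ℕ
  indices = range {N} (k ∸ ∣ R ∣) (k ⊓ ∣ L ∣)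

  labels-leaves : ∀ js → labels (map leaf js) ≡ js
  labels-leaves []       = refl
  labels-leaves (j ∷ js) = cong (j ∷_) (labels-leaves js)

  some-leaf-falls⇔ : ∀ {S} → S ⊆ L ∪ R → Any (λ j → FallsAt j S) indices ⇔ k ≤ ∣ S ∣
  some-leaf-falls⇔ {S} S⊆V = mk⇔ to from
    where
      |S|≡ = ∣p∣≡∣p∩q∣+∣p∩r∣ S L R L#R S⊆V
      to : Any (λ j → FallsAt j S) indices → k ≤ ∣ S ∣
      to falls with find falls
      ... | j , _ , (j≤a , k∸j≤b) = ≤-trans (m≤n+m∸n k j) (≤-trans (+-mono-≤ j≤a k∸j≤b) (≤-reflexive (sym |S|≡)))
      from : k ≤ ∣ S ∣ → Any (λ j → FallsAt j S) indices
      from k≤|S| with some-index-falls (∣p∩q∣≤∣q∣ S L) (∣p∩q∣≤∣q∣ S R) (subst (k ≤_) |S|≡ k≤|S|)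
      ... | j , (lo≤j , j≤hi) , falls = lose (∈-range⁺ {N} lo≤j j≤hi) falls

  split-solves : ∀ {w} → Huffman (Dlist k ∣ L ∣ ∣ R ∣ HL HR) w → IsOn (L ∪ R) w × Solves (L ∪ R) (kof k (L ∪ R)) w
  split-solves {w} h = IsOn-huffman h (Allₚ.map⁺ (All.tabulate (Dexpr-on ∘ range-feasible {N}))) , solves
    where
      tree = huffman-vanishes h (map leaf indices) (↭-reflexive (sym (map-∘ indices)))
               (Allₚ.map⁺ (All.tabulate (leaf-sound ∘ range-feasible {N})))
               (subst Unique (sym (labels-leaves indices)) (range-unique {N} _ _))
      J = proj₁ tree
      J↭indices : J ↭ indices
      J↭indices = subst (J ↭_) (labels-leaves indices) (proj₁ (proj₂ tree))
      solves : Solves (L ∪ R) (kof k (L ∪ R)) w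
      solves S S⊆V = begin
        IsZero (restrict S w)            ≈⟨ IsZero⇔≈[] ⟩
        restrict S w ≈ []                ≈⟨ proj₂ (proj₂ tree) S S⊆V ⟩
        Any (λ j → FallsAt j S) J        ≈⟨ mk⇔ (↭ₚ.Any-resp-↭ J↭indices) (↭ₚ.Any-resp-↭ (↭-sym J↭indices)) ⟩
        Any (λ j → FallsAt j S) indices  ≈⟨ some-leaf-falls⇔ S⊆V ⟩
        k ≤ ∣ S ∣                        ≈⟨ kof≡fall⇔ k (L ∪ R) S ⟨
        kof k (L ∪ R) S ≡ fall           ∎
        where open SetoidReasoning (⇔-setoid 0ℓ)

theorem3p5 : ∀ {N : ℕ} (V : Subset N) (k : ℕ) (w : Word N) →
    1 ≤ ∣ V ∣ → 1 ≤ k → k ≤ ∣ V ∣ →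
    Built V k w →
    IsOn V w × Solves V (kof k V) w
theorem3p5 _ k _ _ 1≤k k≤|V| (single v) = singleton-solves v 1≤k k≤|V|
theorem3p5 _ k _ _ 1≤k _ (split L R _ _ L#R HL HR familyL familyR huffman) =
  Construction.split-solves L R L#R HL HR familyL familyR k 1≤k huffman
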